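{- Let $p_1,\dots,p_{q+1}$ be distinct nonzero elements of $K$. Then no three of the points $p_1,\dots,p_{q+1}$ are collinear in $AG(2,q)$ (i.e. they form an oval) if and only if the $q+1$ lines $\ell_i=\{x\in K: T(p_ix)=1\}$, $i=1,\dots,q+1$, form a line oval of $PG(2,q)$, i.e. no three of them pass through a common point of $AG(2,q)$ and no three of them are mutually parallel (parallel lines meeting at their common point at infinity).
   Context: Let $m\ge1$, $q=2^m$, $F=\mathbb{F}_q\subseteq K=\mathbb{F}_{q^2}$, $T(x)=x+x^q\in F$. $K$ is regarded as the affine plane $AG(2,q)$ (2-dimensional $F$-vector space, lines are cosets of 1-dimensional $F$-subspaces), and $PG(2,q)$ is its projective completion obtained by adding one point at infinity for each parallel class of lines and the line at infinity. -}

module Defs where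

open import Level using (0ℓ)
open import Data.Nat as ℕ using (ℕ; zero; suc)
open import Data.Fin using (Fin)
open import Data.Product using (Σ; ∃; _×_)
open import Relation.Binary.PropositionalEquality using (_≡_; _≢_)
open import Relation.Nullary using (¬_)
open import Function.Bundles using (_↔_; _⇔_)
open import Algebra.Structures using (IsCommutativeRing)

record FiniteField (n : ℕ) : Set₁ where
  infixl 6 _+_
  infixl 7 _*_
  field
    Carrier : Set
    _+_ _*_ : Carrier → Carrier → Carrier
    -_ : Carrier → Carrier
    0# 1# : Carrier
    isCommutativeRing : IsCommutativeRing _≡_ _+_ _*_ -_ 0# 1#
    0≢1 : 0# ≢ 1#
    inverse : ∀ x → x ≢ 0# → ∃ λ y → x * y ≡ 1#
    enumeration : Carrier ↔ Fin n

  _^_ : Carrier → ℕ → Carrier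
  x ^ zero = 1#
  x ^ suc k = x * (x ^ k)

module Geometry (m : ℕ) (K : FiniteField ((2 ℕ.^ m) ℕ.* (2 ℕ.^ m))) where
  open FiniteField K

  q : ℕ
  q = 2 ℕ.^ m

  InF : Carrier → Set
  InF x = x ^ q ≡ x

  T : Carrier → Carrier
  T x = x + x ^ q

  -- three points of AG(2,q) = K lie on a common line  a + F·d  (d ≠ 0)
  Collinear : Carrier → Carrier → Carrier → Set
  Collinear x y z =
    Σ Carrier λ a → Σ Carrier λ d → d ≢ 0# ×
      (Σ Carrier λ s → InF s × x ≡ a + s * d) ×
      (Σ Carrier λ s → InF s × y ≡ a + s * d) ×
      (Σ Carrier λ s → InF s × z ≡ a + s * d)

  NoThreeCollinear : (Fin (suc q) → Carrier) → Set
  NoThreeCollinear pt = ∀ i j k → i ≢ j → j ≢ k → i ≢ k →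
    ¬ Collinear (pt i) (pt j) (pt k)

  OnLine : Carrier → Carrier → Set
  OnLine p x = T (p * x) ≡ 1#

  Parallel : Carrier → Carrier → Set
  Parallel p r = Σ Carrier λ t → ∀ x → (OnLine p x ⇔ OnLine r (x + t))

  Concurrent : Carrier → Carrier → Carrier → Set
  Concurrent a b c = Σ Carrier λ x → OnLine a x × OnLine b x × OnLine c x

  MutuallyParallel : Carrier → Carrier → Carrier → Set
  MutuallyParallel a b c = Parallel a b × Parallel b c × Parallel a c

  LineOval : (Fin (suc q) → Carrier) → Set
  LineOval pt = ∀ i j k → i ≢ j → j ≢ k → i ≢ k →
    ¬ Concurrent (pt i) (pt j) (pt k) × ¬ MutuallyParallel (pt i) (pt j) (pt k)

-- Over K = F_{q²} the trace T(x) = x + x^q is F-linear with kernel F, and some y₁ has T(y₁) = 1.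
-- If three points p lie on a line a₀ + F d with w = a₀/d ∉ F, every ℓ_p passes through
-- 1/(T(w) d); if w ∈ F, the points are σ d with σ ∈ F*, and ℓ_{σd} = {x : T(d x) = 1/σ}
-- are translates of each other. Conversely, the p whose lines share a point x lie on the
-- line {p : T(p x) = 1} = a + F/x, and ℓ_a ∥ ℓ_b forces b/a ∈ F, so p ∈ F a.
-- The finite-field facts used are x^{q²} = x (Lagrange), characteristic 2 (the cardinality
-- is even), and T ≢ 0 (a polynomial of degree q < q² has a non-root).

module Submission where

open import Defs
open import Data.Nat using (ℕ; suc; _≤_; _^_; _*_)
open import Data.Fin using (Fin)
open import Relation.Binary.PropositionalEquality using (_≡_; _≢_)
open import Function.Definitions using (Injective)
open import Function.Bundles using (_⇔_)

open import Level using (0ℓ)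
open import Data.Nat as ℕ using (zero; z≤n; s≤s)
import Data.Nat.Properties as ℕP
import Data.Fin as Fin
import Data.Fin.Properties as FinP
open import Data.Product using (Σ; ∃; _×_; _,_; proj₁; proj₂; map)
open import Data.Sum using (_⊎_; inj₁; inj₂)
open import Data.Empty using (⊥-elim)
open import Data.List using (List; []; _∷_; length; replicate)
open import Data.List.Properties using (length-replicate)
open import Data.Vec.Functional using (Vector)
open import Data.Fin.Permutation using (Permutation′; permutation)
open import Relation.Nullary using (¬_; Dec; yes; no)
open import Relation.Binary.PropositionalEquality
  using (refl; sym; trans; cong; cong₂; subst; subst₂; module ≡-Reasoning)
open import Relation.Binary.Definitions using (DecidableEquality)
open import Function.Base using (_∘_; id)
open import Function.Bundles using (Inverse; mk⇔; Equivalence)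
open import Function.Properties.Inverse using (↔⇒↣)
open import Algebra.Bundles using (CommutativeRing)
open import Algebra.Structures using (IsCommutativeRing)
import Algebra.Properties.CommutativeMonoid.Sum as MonoidSum
import Algebra.Properties.Ring as RingProperties
import Algebra.Properties.Group as GroupProperties
import Algebra.Solver.Ring.NaturalCoefficients.Default as NaturalSolver

module FiniteFieldLemmas {n : ℕ} (K : FiniteField n) where
  open FiniteField K renaming (_*_ to _·_; _^_ to _^ᴷ_)
  open IsCommutativeRing isCommutativeRing
    using (+-comm; +-assoc; +-identityˡ; +-identityʳ; *-comm; *-assoc; *-identityˡ; *-identityʳ; zeroˡ; zeroʳ)
  open ≡-Reasoning

  commutativeRing : CommutativeRing 0ℓ 0ℓ
  commutativeRing = record { isCommutativeRing = isCommutativeRing }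

  open NaturalSolver (CommutativeRing.commutativeSemiring commutativeRing)
    using (solve; _:+_; _:*_; _:=_; con)

  element : Fin n → Carrier
  element = Inverse.from enumeration

  index : Carrier → Fin n
  index = Inverse.to enumeration

  element-index : ∀ x → element (index x) ≡ x
  element-index = Inverse.strictlyInverseʳ enumeration

  index-element : ∀ i → index (element i) ≡ i
  index-element = Inverse.strictlyInverseˡ enumeration

  element-injective : Injective _≡_ _≡_ element
  element-injective {i} {j} eᵢ≡eⱼ = begin
    i                 ≡⟨ sym (index-element i) ⟩
    index (element i) ≡⟨ cong index eᵢ≡eⱼ ⟩
    index (element j) ≡⟨ index-element j ⟩
    j                 ∎

  infix 4 _≟_
  _≟_ : DecidableEquality Carrier
  _≟_ = FinP.inj⇒≟ (↔⇒↣ enumeration)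

  1≢0 : 1# ≢ 0#
  1≢0 = 0≢1 ∘ sym

  inv : (x : Carrier) → x ≢ 0# → Carrier
  inv x x≢0 = proj₁ (inverse x x≢0)

  *-inverseʳ : ∀ x (x≢0 : x ≢ 0#) → x · inv x x≢0 ≡ 1#
  *-inverseʳ x x≢0 = proj₂ (inverse x x≢0)

  *-inverseˡ : ∀ x (x≢0 : x ≢ 0#) → inv x x≢0 · x ≡ 1#
  *-inverseˡ x x≢0 = trans (*-comm _ x) (*-inverseʳ x x≢0)

  *-cancelˡ : ∀ x {y z} → x ≢ 0# → x · y ≡ x · z → y ≡ z
  *-cancelˡ x {y} {z} x≢0 xy≡xz = begin
    y                   ≡⟨ sym (*-identityˡ y) ⟩
    1# · y              ≡⟨ cong (_· y) (sym (*-inverseˡ x x≢0)) ⟩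
    inv x x≢0 · x · y   ≡⟨ *-assoc _ x y ⟩
    inv x x≢0 · (x · y) ≡⟨ cong (inv x x≢0 ·_) xy≡xz ⟩
    inv x x≢0 · (x · z) ≡⟨ sym (*-assoc _ x z) ⟩
    inv x x≢0 · x · z   ≡⟨ cong (_· z) (*-inverseˡ x x≢0) ⟩
    1# · z              ≡⟨ *-identityˡ z ⟩
    z                   ∎

  *-≢0 : ∀ {x y} → x ≢ 0# → y ≢ 0# → x · y ≢ 0#
  *-≢0 {x} x≢0 y≢0 xy≡0 = y≢0 (*-cancelˡ x x≢0 (trans xy≡0 (sym (zeroʳ x))))

  inv-≢0 : ∀ x (x≢0 : x ≢ 0#) → inv x x≢0 ≢ 0#
  inv-≢0 x x≢0 x⁻¹≡0 = 1≢0 (begin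
    1#            ≡⟨ sym (*-inverseʳ x x≢0) ⟩
    x · inv x x≢0 ≡⟨ cong (x ·_) x⁻¹≡0 ⟩
    x · 0#        ≡⟨ zeroʳ x ⟩
    0#            ∎)

  inv-unique : ∀ x {y} (x≢0 : x ≢ 0#) → x · y ≡ 1# → y ≡ inv x x≢0
  inv-unique x x≢0 xy≡1 = *-cancelˡ x x≢0 (trans xy≡1 (sym (*-inverseʳ x x≢0)))

  x·[x⁻¹·y]≡y : ∀ x (x≢0 : x ≢ 0#) y → x · (inv x x≢0 · y) ≡ y
  x·[x⁻¹·y]≡y x x≢0 y = begin
    x · (inv x x≢0 · y) ≡⟨ sym (*-assoc x _ y) ⟩
    x · inv x x≢0 · y   ≡⟨ cong (_· y) (*-inverseʳ x x≢0) ⟩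
    1# · y              ≡⟨ *-identityˡ y ⟩
    y                   ∎

  ^-distribˡ-+-* : ∀ x a b → x ^ᴷ (a ℕ.+ b) ≡ x ^ᴷ a · x ^ᴷ b
  ^-distribˡ-+-* x zero    b = sym (*-identityˡ _)
  ^-distribˡ-+-* x (suc a) b = trans (cong (x ·_) (^-distribˡ-+-* x a b)) (sym (*-assoc x _ _))

  ^-distribʳ-* : ∀ x y a → (x · y) ^ᴷ a ≡ x ^ᴷ a · y ^ᴷ a
  ^-distribʳ-* x y zero    = sym (*-identityˡ 1#)
  ^-distribʳ-* x y (suc a) = trans (cong (x · y ·_) (^-distribʳ-* x y a))
    (solve 4 (λ x y u v → x :* y :* (u :* v) := x :* u :* (y :* v)) refl x y (x ^ᴷ a) (y ^ᴷ a))

  1^n≡1 : ∀ a → 1# ^ᴷ a ≡ 1#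
  1^n≡1 zero    = refl
  1^n≡1 (suc a) = trans (*-identityˡ _) (1^n≡1 a)

  0^n≡0 : ∀ a → Fin a → 0# ^ᴷ a ≡ 0#
  0^n≡0 (suc a) _ = zeroˡ _

  ^-*-assoc : ∀ x a b → (x ^ᴷ a) ^ᴷ b ≡ x ^ᴷ (a * b)
  ^-*-assoc x zero    b = 1^n≡1 b
  ^-*-assoc x (suc a) b = begin
    (x · x ^ᴷ a) ^ᴷ b        ≡⟨ ^-distribʳ-* x (x ^ᴷ a) b ⟩
    x ^ᴷ b · (x ^ᴷ a) ^ᴷ b   ≡⟨ cong (x ^ᴷ b ·_) (^-*-assoc x a b) ⟩
    x ^ᴷ b · x ^ᴷ (a * b)    ≡⟨ sym (^-distribˡ-+-* x b (a * b)) ⟩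
    x ^ᴷ (b ℕ.+ a * b)       ∎

  module Π = MonoidSum (CommutativeRing.*-commutativeMonoid commutativeRing)

  Π : ∀ {k} → Vector Carrier k → Carrier
  Π = Π.sum

  Π-const : ∀ k a → Π {k} (λ _ → a) ≡ a ^ᴷ k
  Π-const zero    a = refl
  Π-const (suc k) a = cong (a ·_) (Π-const k a)

  Π-≢0 : ∀ {k} (f : Vector Carrier k) → (∀ i → f i ≢ 0#) → Π f ≢ 0#
  Π-≢0 {zero}  f f≢0 = 1≢0
  Π-≢0 {suc k} f f≢0 = *-≢0 (f≢0 Fin.zero) (Π-≢0 (f ∘ Fin.suc) (f≢0 ∘ Fin.suc))

  Π-single : ∀ {k} (f : Vector Carrier k) j → (∀ i → i ≢ j → f i ≡ 1#) → Π f ≡ f j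
  Π-single {suc k} f Fin.zero    f≡1 = begin
    f Fin.zero · Π (f ∘ Fin.suc)  ≡⟨ cong (f Fin.zero ·_) (Π.sum-cong-≗ (λ i → f≡1 (Fin.suc i) λ ())) ⟩
    f Fin.zero · Π {k} (λ _ → 1#) ≡⟨ cong (f Fin.zero ·_) (trans (Π-const k 1#) (1^n≡1 k)) ⟩
    f Fin.zero · 1#               ≡⟨ *-identityʳ _ ⟩
    f Fin.zero                    ∎
  Π-single {suc k} f (Fin.suc j) f≡1 = begin
    f Fin.zero · Π (f ∘ Fin.suc) ≡⟨ cong₂ _·_ (f≡1 Fin.zero λ ()) (Π-single (f ∘ Fin.suc) j
                                       (λ i i≢j → f≡1 (Fin.suc i) (i≢j ∘ FinP.suc-injective))) ⟩
    1# · f (Fin.suc j)           ≡⟨ *-identityˡ _ ⟩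
    f (Fin.suc j)                ∎

  nonzeroPart : Carrier → Carrier
  nonzeroPart x with x ≟ 0#
  ... | yes _ = 1#
  ... | no  _ = x

  nonzeroPart-≢0 : ∀ x → nonzeroPart x ≢ 0#
  nonzeroPart-≢0 x with x ≟ 0#
  ... | yes _   = 1≢0
  ... | no  x≢0 = x≢0

  atZero : Carrier → Carrier → Carrier
  atZero a x with x ≟ 0#
  ... | yes _ = a
  ... | no  _ = 1#

  nonzeroPart-* : ∀ {a} → a ≢ 0# → ∀ x → nonzeroPart (a · x) · atZero a x ≡ a · nonzeroPart x
  nonzeroPart-* {a} a≢0 x with x ≟ 0# | a · x ≟ 0#
  ... | yes _   | yes _    = *-comm 1# a
  ... | yes x≡0 | no  ax≢0 = ⊥-elim (ax≢0 (trans (cong (a ·_) x≡0) (zeroʳ a)))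
  ... | no  x≢0 | yes ax≡0 = ⊥-elim (*-≢0 a≢0 x≢0 ax≡0)
  ... | no  _   | no  _    = *-identityʳ (a · x)

  Π-atZero : ∀ a → Π (atZero a ∘ element) ≡ a
  Π-atZero a = begin
    Π (atZero a ∘ element)        ≡⟨ Π-single (atZero a ∘ element) (index 0#) atZero≡1 ⟩
    atZero a (element (index 0#)) ≡⟨ cong (atZero a) (element-index 0#) ⟩
    atZero a 0#                   ≡⟨ atZero-0 ⟩
    a                             ∎
    where
    atZero-0 : atZero a 0# ≡ a
    atZero-0 with 0# ≟ 0#
    ... | yes _   = refl
    ... | no  0≢0 = ⊥-elim (0≢0 refl)
    atZero≡1 : ∀ i → i ≢ index 0# → atZero a (element i) ≡ 1#
    atZero≡1 i i≢0 with element i ≟ 0#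
    ... | yes eᵢ≡0 = ⊥-elim (i≢0 (trans (sym (index-element i)) (cong index eᵢ≡0)))
    ... | no  _    = refl

  scale-inverse : ∀ {b c} → b · c ≡ 1# → ∀ i → index (b · element (index (c · element i))) ≡ i
  scale-inverse {b} {c} bc≡1 i = begin
    index (b · element (index (c · element i))) ≡⟨ cong (λ y → index (b · y)) (element-index _) ⟩
    index (b · (c · element i))                 ≡⟨ cong index (sym (*-assoc b c _)) ⟩
    index (b · c · element i)                   ≡⟨ cong (λ y → index (y · element i)) bc≡1 ⟩
    index (1# · element i)                      ≡⟨ cong index (*-identityˡ _) ⟩
    index (element i)                           ≡⟨ index-element i ⟩
    i                                           ∎

  -- Lagrange's argument: multiplication by a permutes K, and nonzeroPart · atZero a
  -- repairs the one place (x = 0) where it fails to scale nonzeroPart by a.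
  ^-card-≢0 : ∀ {a} → a ≢ 0# → a ^ᴷ n ≡ a
  ^-card-≢0 {a} a≢0 = sym (*-cancelˡ (Π ν) (Π-≢0 ν (nonzeroPart-≢0 ∘ element)) (begin
    Π ν · a                                        ≡⟨ cong₂ _·_ (Π.sum-permute ν scaling) (sym (Π-atZero a)) ⟩
    Π (ν ∘ scale) · Π (atZero a ∘ element)         ≡⟨ sym (Π.∑-distrib-+ (ν ∘ scale) (atZero a ∘ element)) ⟩
    Π (λ i → ν (scale i) · atZero a (element i))   ≡⟨ Π.sum-cong-≗ scaled ⟩
    Π (λ i → a · ν i)                              ≡⟨ Π.∑-distrib-+ (λ _ → a) ν ⟩
    Π {n} (λ _ → a) · Π ν                          ≡⟨ cong (_· Π ν) (Π-const n a) ⟩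
    a ^ᴷ n · Π ν                                   ≡⟨ *-comm _ (Π ν) ⟩
    Π ν · a ^ᴷ n                                   ∎))
    where
    ν : Fin n → Carrier
    ν = nonzeroPart ∘ element
    scale : Fin n → Fin n
    scale i = index (a · element i)
    scaling : Permutation′ n
    scaling = permutation scale (λ i → index (inv a a≢0 · element i))
      (scale-inverse (*-inverseʳ a a≢0)) (scale-inverse (*-inverseˡ a a≢0))
    scaled : ∀ i → ν (scale i) · atZero a (element i) ≡ a · ν i
    scaled i = trans (cong (λ y → nonzeroPart y · atZero a (element i)) (element-index _))
                     (nonzeroPart-* a≢0 (element i))

  ^-card : ∀ x → x ^ᴷ n ≡ x
  ^-card x with x ≟ 0#
  ... | no  x≢0 = ^-card-≢0 x≢0
  ... | yes refl = 0^n≡0 n (index 0#)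

  -- (-1)^n is -1 by ^-card but 1 since n is even.
  even-card⇒1+1≡0 : ∀ k → n ≡ 2 * k → 1# + 1# ≡ 0#
  even-card⇒1+1≡0 k n≡2k = begin
    1# + 1#   ≡⟨ cong (1# +_) 1≡-1 ⟩
    1# + - 1# ≡⟨ -‿inverseʳ 1# ⟩
    0#        ∎
    where
    open IsCommutativeRing isCommutativeRing using (-‿inverseʳ)
    open RingProperties (CommutativeRing.ring commutativeRing) using (-1*x≈-x)
    open GroupProperties (CommutativeRing.+-group commutativeRing) using (⁻¹-involutive)
    [-1]²≡1 : (- 1#) ^ᴷ 2 ≡ 1#
    [-1]²≡1 = trans (cong (- 1# ·_) (*-identityʳ _)) (trans (-1*x≈-x (- 1#)) (⁻¹-involutive 1#))
    1≡-1 : 1# ≡ - 1#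
    1≡-1 = begin
      1#                    ≡⟨ sym (1^n≡1 k) ⟩
      1# ^ᴷ k               ≡⟨ cong (_^ᴷ k) (sym [-1]²≡1) ⟩
      ((- 1#) ^ᴷ 2) ^ᴷ k    ≡⟨ ^-*-assoc (- 1#) 2 k ⟩
      (- 1#) ^ᴷ (2 * k)     ≡⟨ cong ((- 1#) ^ᴷ_) (sym n≡2k) ⟩
      (- 1#) ^ᴷ n           ≡⟨ ^-card (- 1#) ⟩
      - 1#                  ∎

  xz≡yz∧x≢y⇒z≡0 : ∀ {x y z} → x · z ≡ y · z → x ≢ y → z ≡ 0#
  xz≡yz∧x≢y⇒z≡0 {x} {y} {z} xz≡yz x≢y with z ≟ 0#
  ... | yes z≡0 = z≡0
  ... | no  z≢0 = ⊥-elim (x≢y (*-cancelˡ z z≢0 (trans (*-comm z x) (trans xz≡yz (*-comm y z)))))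

  -- [c₀, …, c_{d-1}] encodes the monic polynomial x^d + c_{d-1} x^{d-1} + ⋯ + c₀.
  evalMonic : List Carrier → Carrier → Carrier
  evalMonic []       x = 1#
  evalMonic (c ∷ cs) x = c + x · evalMonic cs x

  evalMonic-replicate-0 : ∀ j x → evalMonic (replicate j 0#) x ≡ x ^ᴷ j
  evalMonic-replicate-0 zero    x = refl
  evalMonic-replicate-0 (suc j) x = trans (+-identityˡ _) (cong (x ·_) (evalMonic-replicate-0 j x))

  -- deflate cs r is the quotient of c ∷ cs by x - r, for every c.
  deflate : List Carrier → Carrier → List Carrier
  deflate []       r = []
  deflate (c ∷ cs) r = evalMonic (c ∷ cs) r ∷ deflate cs r

  length-deflate : ∀ cs r → length (deflate cs r) ≡ length cs
  length-deflate []       r = refl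
  length-deflate (c ∷ cs) r = cong suc (length-deflate cs r)

  -- p(x) = (x - r) q(x) + p(r), with both sides moved so that no subtraction occurs.
  evalMonic-deflate : ∀ c cs r x →
    evalMonic (c ∷ cs) x + r · evalMonic (deflate cs r) x ≡ x · evalMonic (deflate cs r) x + evalMonic (c ∷ cs) r
  evalMonic-deflate c []        r x =
    solve 3 (λ c r x → c :+ x :* con 1 :+ r :* con 1 := x :* con 1 :+ (c :+ r :* con 1)) refl c r x
  evalMonic-deflate c (c′ ∷ cs) r x = begin
    c + x · H x + r · (H r + x · Q)       ≡⟨ solve 6 (λ c x r Hx Hr Q →
                                                 c :+ x :* Hx :+ r :* (Hr :+ x :* Q) := c :+ r :* Hr :+ x :* (Hx :+ r :* Q))
                                               refl c x r (H x) (H r) Q ⟩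
    c + r · H r + x · (H x + r · Q)       ≡⟨ cong (λ y → c + r · H r + x · y) (evalMonic-deflate c′ cs r x) ⟩
    c + r · H r + x · (x · Q + H r)       ≡⟨ solve 5 (λ c x r Hr Q →
                                                 c :+ r :* Hr :+ x :* (x :* Q :+ Hr) := x :* (Hr :+ x :* Q) :+ (c :+ r :* Hr))
                                               refl c x r (H r) Q ⟩
    x · (H r + x · Q) + (c + r · H r)     ∎
    where
    H : Carrier → Carrier
    H = evalMonic (c′ ∷ cs)
    Q : Carrier
    Q = evalMonic (deflate cs r) x

  roots≤degree : ∀ {k} cs (ρ : Fin k → Carrier) → Injective _≡_ _≡_ ρ →
    (∀ i → evalMonic cs (ρ i) ≡ 0#) → k ≤ length cs
  roots≤degree {zero}  cs       ρ ρ-inj roots = z≤n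
  roots≤degree {suc k} []       ρ ρ-inj roots = ⊥-elim (1≢0 (roots Fin.zero))
  roots≤degree {suc k} (c ∷ cs) ρ ρ-inj roots = s≤s (subst (k ≤_) (length-deflate cs r)
    (roots≤degree (deflate cs r) (ρ ∘ Fin.suc) (FinP.suc-injective ∘ ρ-inj) deflated-roots))
    where
    r : Carrier
    r = ρ Fin.zero
    deflated-roots : ∀ i → evalMonic (deflate cs r) (ρ (Fin.suc i)) ≡ 0#
    deflated-roots i = xz≡yz∧x≢y⇒z≡0 rQ≡xQ (FinP.0≢1+n ∘ ρ-inj)
      where
      x Q : Carrier
      x = ρ (Fin.suc i)
      Q = evalMonic (deflate cs r) x
      rQ≡xQ : r · Q ≡ x · Q
      rQ≡xQ = begin
        r · Q                           ≡⟨ sym (+-identityˡ _) ⟩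
        0# + r · Q                      ≡⟨ cong (_+ r · Q) (sym (roots (Fin.suc i))) ⟩
        evalMonic (c ∷ cs) x + r · Q    ≡⟨ evalMonic-deflate c cs r x ⟩
        x · Q + evalMonic (c ∷ cs) r    ≡⟨ cong (x · Q +_) (roots Fin.zero) ⟩
        x · Q + 0#                      ≡⟨ +-identityʳ _ ⟩
        x · Q                           ∎

  ∃nonRoot : ∀ cs → length cs ℕ.< n → ∃ λ x → evalMonic cs x ≢ 0#
  ∃nonRoot cs deg<n = map element id (FinP.¬∀⟶∃¬ n _ (λ i → evalMonic cs (element i) ≟ 0#) all-roots-absurd)
    where
    all-roots-absurd : ¬ (∀ i → evalMonic cs (element i) ≡ 0#)
    all-roots-absurd roots = ℕP.<⇒≱ deg<n (roots≤degree cs element element-injective roots)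

  module CharacteristicTwo (1+1≡0 : 1# + 1# ≡ 0#) where

    x+x≡0 : ∀ x → x + x ≡ 0#
    x+x≡0 x = begin
      x + x         ≡⟨ solve 1 (λ x → x :+ x := x :* (con 1 :+ con 1)) refl x ⟩
      x · (1# + 1#) ≡⟨ cong (x ·_) 1+1≡0 ⟩
      x · 0#        ≡⟨ zeroʳ x ⟩
      0#            ∎

    x+[x+y]≡y : ∀ x y → x + (x + y) ≡ y
    x+[x+y]≡y x y = begin
      x + (x + y) ≡⟨ sym (+-assoc x x y) ⟩
      x + x + y   ≡⟨ cong (_+ y) (x+x≡0 x) ⟩
      0# + y      ≡⟨ +-identityˡ y ⟩
      y           ∎

    x+y≡0⇒x≡y : ∀ {x y} → x + y ≡ 0# → x ≡ y
    x+y≡0⇒x≡y {x} {y} x+y≡0 = begin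
      x           ≡⟨ sym (x+[x+y]≡y y x) ⟩
      y + (y + x) ≡⟨ cong (y +_) (trans (+-comm y x) x+y≡0) ⟩
      y + 0#      ≡⟨ +-identityʳ y ⟩
      y           ∎

    x≡y⇒x+y≡0 : ∀ {x y} → x ≡ y → x + y ≡ 0#
    x≡y⇒x+y≡0 {x} refl = x+x≡0 x

    x≡x+y⇒y≡0 : ∀ {x y} → x ≡ x + y → y ≡ 0#
    x≡x+y⇒y≡0 {x} {y} x≡x+y = begin
      y           ≡⟨ sym (x+[x+y]≡y x y) ⟩
      x + (x + y) ≡⟨ cong (x +_) (sym x≡x+y) ⟩
      x + x       ≡⟨ x+x≡0 x ⟩
      0#          ∎

    [x+y]²≡x²+y² : ∀ x y → (x + y) ^ᴷ 2 ≡ x ^ᴷ 2 + y ^ᴷ 2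
    [x+y]²≡x²+y² x y = begin
      (x + y) ^ᴷ 2                         ≡⟨ solve 2 (λ x y → (x :+ y) :* ((x :+ y) :* con 1)
                                                 := x :* (x :* con 1) :+ y :* (y :* con 1) :+ x :* y :* (con 1 :+ con 1))
                                               refl x y ⟩
      x ^ᴷ 2 + y ^ᴷ 2 + x · y · (1# + 1#)  ≡⟨ cong (λ z → x ^ᴷ 2 + y ^ᴷ 2 + x · y · z) 1+1≡0 ⟩
      x ^ᴷ 2 + y ^ᴷ 2 + x · y · 0#         ≡⟨ cong (x ^ᴷ 2 + y ^ᴷ 2 +_) (zeroʳ _) ⟩
      x ^ᴷ 2 + y ^ᴷ 2 + 0#                 ≡⟨ +-identityʳ _ ⟩
      x ^ᴷ 2 + y ^ᴷ 2                      ∎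

    frobenius-+ : ∀ k x y → (x + y) ^ᴷ (2 ^ k) ≡ x ^ᴷ (2 ^ k) + y ^ᴷ (2 ^ k)
    frobenius-+ zero    x y = solve 2 (λ x y → (x :+ y) :* con 1 := x :* con 1 :+ y :* con 1) refl x y
    frobenius-+ (suc k) x y = begin
      (x + y) ^ᴷ (2 * 2 ^ k)                      ≡⟨ sym (^-*-assoc (x + y) 2 (2 ^ k)) ⟩
      ((x + y) ^ᴷ 2) ^ᴷ (2 ^ k)                   ≡⟨ cong (_^ᴷ (2 ^ k)) ([x+y]²≡x²+y² x y) ⟩
      (x ^ᴷ 2 + y ^ᴷ 2) ^ᴷ (2 ^ k)                ≡⟨ frobenius-+ k (x ^ᴷ 2) (y ^ᴷ 2) ⟩
      (x ^ᴷ 2) ^ᴷ (2 ^ k) + (y ^ᴷ 2) ^ᴷ (2 ^ k)   ≡⟨ cong₂ _+_ (^-*-assoc x 2 (2 ^ k)) (^-*-assoc y 2 (2 ^ k)) ⟩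
      x ^ᴷ (2 * 2 ^ k) + y ^ᴷ (2 * 2 ^ k)         ∎

module LineOvalDuality (m′ : ℕ) (K : FiniteField (2 ^ suc m′ * 2 ^ suc m′)) where
  open FiniteField K renaming (_*_ to _·_; _^_ to _^ᴷ_)
  open IsCommutativeRing isCommutativeRing
    using (+-comm; +-assoc; +-identityˡ; +-identityʳ; *-comm; *-assoc; *-identityˡ; *-identityʳ; zeroˡ; zeroʳ)
  open FiniteFieldLemmas K
  open NaturalSolver (CommutativeRing.commutativeSemiring commutativeRing)
    using (solve; _:+_; _:*_; _:=_; con)
  open Geometry (suc m′) K
  open CharacteristicTwo (even-card⇒1+1≡0 (2 ^ m′ * q) (ℕP.*-assoc 2 (2 ^ m′) q))
  open ≡-Reasoning

  frob : Carrier → Carrier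
  frob x = x ^ᴷ q

  frob-+ : ∀ x y → frob (x + y) ≡ frob x + frob y
  frob-+ = frobenius-+ (suc m′)

  frob-· : ∀ x y → frob (x · y) ≡ frob x · frob y
  frob-· x y = ^-distribʳ-* x y q

  frob-involutive : ∀ x → frob (frob x) ≡ x
  frob-involutive x = trans (^-*-assoc x q q) (^-card x)

  InF-1 : InF 1#
  InF-1 = 1^n≡1 q

  InF-+ : ∀ {s t} → InF s → InF t → InF (s + t)
  InF-+ {s} {t} s∈F t∈F = trans (frob-+ s t) (cong₂ _+_ s∈F t∈F)

  InF-· : ∀ {s t} → InF s → InF t → InF (s · t)
  InF-· {s} {t} s∈F t∈F = trans (frob-· s t) (cong₂ _·_ s∈F t∈F)

  InF-inv : ∀ {s} (s≢0 : s ≢ 0#) → InF s → InF (inv s s≢0)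
  InF-inv {s} s≢0 s∈F = *-cancelˡ s s≢0 (begin
    s · frob s⁻¹       ≡⟨ cong (_· frob s⁻¹) (sym s∈F) ⟩
    frob s · frob s⁻¹  ≡⟨ sym (frob-· s s⁻¹) ⟩
    frob (s · s⁻¹)     ≡⟨ cong frob (*-inverseʳ s s≢0) ⟩
    frob 1#            ≡⟨ InF-1 ⟩
    1#                 ≡⟨ sym (*-inverseʳ s s≢0) ⟩
    s · s⁻¹            ∎)
    where
    s⁻¹ : Carrier
    s⁻¹ = inv s s≢0

  T-InF : ∀ y → InF (T y)
  T-InF y = begin
    frob (y + frob y)        ≡⟨ frob-+ y (frob y) ⟩
    frob y + frob (frob y)   ≡⟨ cong (frob y +_) (frob-involutive y) ⟩
    frob y + y               ≡⟨ +-comm (frob y) y ⟩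
    y + frob y               ∎

  T-+ : ∀ x y → T (x + y) ≡ T x + T y
  T-+ x y = begin
    x + y + frob (x + y)       ≡⟨ cong (x + y +_) (frob-+ x y) ⟩
    x + y + (frob x + frob y)  ≡⟨ solve 4 (λ a b c d → a :+ b :+ (c :+ d) := a :+ c :+ (b :+ d))
                                    refl x y (frob x) (frob y) ⟩
    x + frob x + (y + frob y)  ∎

  T-· : ∀ {s} y → InF s → T (s · y) ≡ s · T y
  T-· {s} y s∈F = begin
    s · y + frob (s · y)   ≡⟨ cong (s · y +_) (trans (frob-· s y) (cong (_· frob y) s∈F)) ⟩
    s · y + s · frob y     ≡⟨ solve 3 (λ s y z → s :* y :+ s :* z := s :* (y :+ z)) refl s y (frob y) ⟩
    s · (y + frob y)       ∎

  T≡0⇒InF : ∀ {y} → T y ≡ 0# → InF y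
  T≡0⇒InF Ty≡0 = sym (x+y≡0⇒x≡y Ty≡0)

  InF⇒T≡0 : ∀ {y} → InF y → T y ≡ 0#
  InF⇒T≡0 y∈F = x≡y⇒x+y≡0 (sym y∈F)

  T-0 : T 0# ≡ 0#
  T-0 = x≡x+y⇒y≡0 (trans (cong T (sym (+-identityʳ 0#))) (T-+ 0# 0#))

  q≡2+ : ∃ λ j → q ≡ 2 ℕ.+ j
  q≡2+ with 2 ^ m′ | ℕP.m^n>0 2 m′
  ... | suc t | _ = t ℕ.+ (t ℕ.+ 0) , cong suc (ℕP.+-suc t (t ℕ.+ 0))

  -- T is a polynomial of degree q < q², so it is not identically zero.
  ∃T≢0 : ∃ λ y → T y ≢ 0#
  ∃T≢0 = map id (λ {y} nonRoot Ty≡0 → nonRoot (trans (evalMonic≡T y) Ty≡0)) (∃nonRoot xq+x deg<card)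
    where
    j : ℕ
    j = proj₁ q≡2+
    q≡2+j : q ≡ 2 ℕ.+ j
    q≡2+j = proj₂ q≡2+
    xq+x : List Carrier
    xq+x = 0# ∷ 1# ∷ replicate j 0#
    deg<card : length xq+x ℕ.< q * q
    deg<card = subst₂ ℕ._<_ (cong (2 ℕ.+_) (sym (length-replicate j))) (cong₂ _*_ (sym q≡2+j) (sym q≡2+j))
                 (ℕP.m<m*n (2 ℕ.+ j) (2 ℕ.+ j) (s≤s (s≤s z≤n)))
    evalMonic≡T : ∀ x → evalMonic xq+x x ≡ T x
    evalMonic≡T x = begin
      0# + x · (1# + x · evalMonic (replicate j 0#) x) ≡⟨ cong (λ z → 0# + x · (1# + x · z)) (evalMonic-replicate-0 j x) ⟩
      0# + x · (1# + x · x ^ᴷ j)                        ≡⟨ solve 2 (λ x xʲ → con 0 :+ x :* (con 1 :+ x :* xʲ) := x :+ x :* (x :* xʲ))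
                                                              refl x (x ^ᴷ j) ⟩
      x + x ^ᴷ (2 ℕ.+ j)                                ≡⟨ cong (λ k → x + x ^ᴷ k) (sym q≡2+j) ⟩
      x + x ^ᴷ q                                        ∎

  ∃T≡1 : ∃ λ y → T y ≡ 1#
  ∃T≡1 = c · y , (begin
    T (c · y) ≡⟨ T-· {c} y (InF-inv Ty≢0 (T-InF y)) ⟩
    c · T y   ≡⟨ *-inverseˡ (T y) Ty≢0 ⟩
    1#        ∎)
    where
    y : Carrier
    y = proj₁ ∃T≢0
    Ty≢0 : T y ≢ 0#
    Ty≢0 = proj₂ ∃T≢0
    c : Carrier
    c = inv (T y) Ty≢0

  y₁ : Carrier
  y₁ = proj₁ ∃T≡1

  T-y₁ : T y₁ ≡ 1#
  T-y₁ = proj₂ ∃T≡1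

  T-[s·y₁] : ∀ {s} → InF s → T (s · y₁) ≡ s
  T-[s·y₁] {s} s∈F = trans (T-· y₁ s∈F) (trans (cong (s ·_) T-y₁) (*-identityʳ s))

  OnLine⇒≢0 : ∀ {p x} → OnLine p x → x ≢ 0#
  OnLine⇒≢0 {p} {x} x∈ℓₚ x≡0 = 1≢0 (begin
    1#          ≡⟨ sym x∈ℓₚ ⟩
    T (p · x)   ≡⟨ cong (λ z → T (p · z)) x≡0 ⟩
    T (p · 0#)  ≡⟨ cong T (zeroʳ p) ⟩
    T 0#        ≡⟨ T-0 ⟩
    0#          ∎)

  -- The p with T(p x) = 1 form the line a + F x⁻¹ through any one of them, a.
  concurrent⇒collinear : ∀ {a b c} → Concurrent a b c → Collinear a b c
  concurrent⇒collinear {a} (x , x∈ℓₐ , x∈ℓ_b , x∈ℓ_c) =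
    a , x⁻¹ , inv-≢0 x x≢0 , onDualLine x∈ℓₐ , onDualLine x∈ℓ_b , onDualLine x∈ℓ_c
    where
    x≢0 : x ≢ 0#
    x≢0 = OnLine⇒≢0 x∈ℓₐ
    x⁻¹ : Carrier
    x⁻¹ = inv x x≢0
    onDualLine : ∀ {p} → OnLine p x → Σ Carrier λ s → InF s × p ≡ a + s · x⁻¹
    onDualLine {p} x∈ℓₚ = (p + a) · x , T≡0⇒InF T[[p+a]x]≡0 , sym (begin
      a + (p + a) · x · x⁻¹    ≡⟨ cong (a +_) (*-assoc (p + a) x x⁻¹) ⟩
      a + (p + a) · (x · x⁻¹)  ≡⟨ cong (λ z → a + (p + a) · z) (*-inverseʳ x x≢0) ⟩
      a + (p + a) · 1#         ≡⟨ cong (a +_) (*-identityʳ (p + a)) ⟩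
      a + (p + a)              ≡⟨ cong (a +_) (+-comm p a) ⟩
      a + (a + p)              ≡⟨ x+[x+y]≡y a p ⟩
      p                        ∎)
      where
      T[[p+a]x]≡0 : T ((p + a) · x) ≡ 0#
      T[[p+a]x]≡0 = begin
        T ((p + a) · x)         ≡⟨ cong T (solve 3 (λ p a x → (p :+ a) :* x := p :* x :+ a :* x) refl p a x) ⟩
        T (p · x + a · x)       ≡⟨ T-+ (p · x) (a · x) ⟩
        T (p · x) + T (a · x)   ≡⟨ cong₂ _+_ x∈ℓₚ x∈ℓₐ ⟩
        1# + 1#                 ≡⟨ x+x≡0 1# ⟩
        0#                      ∎

  -- Translating the two points a⁻¹ y₁ and a⁻¹ (y₁ + 1) of ℓₐ into ℓ_b shows T(b a⁻¹) = 0.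
  parallel⇒ratio∈F : ∀ {a b} (a≢0 : a ≢ 0#) → Parallel a b → InF (b · inv a a≢0)
  parallel⇒ratio∈F {a} {b} a≢0 (t , ℓₐ+t≡ℓ_b) = T≡0⇒InF (x≡x+y⇒y≡0 (begin
    1#                             ≡⟨ sym (translate x₂∈ℓₐ) ⟩
    T (b · (x₂ + t))               ≡⟨ cong T (solve 4 (λ b a⁻¹ y t → b :* (a⁻¹ :* (y :+ con 1) :+ t)
                                                        := b :* (a⁻¹ :* y :+ t) :+ b :* a⁻¹)
                                               refl b a⁻¹ y₁ t) ⟩
    T (b · (x₁ + t) + b · a⁻¹)     ≡⟨ T-+ (b · (x₁ + t)) (b · a⁻¹) ⟩
    T (b · (x₁ + t)) + T (b · a⁻¹) ≡⟨ cong (_+ T (b · a⁻¹)) (translate x₁∈ℓₐ) ⟩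
    1# + T (b · a⁻¹)               ∎))
    where
    a⁻¹ x₁ x₂ : Carrier
    a⁻¹ = inv a a≢0
    x₁ = a⁻¹ · y₁
    x₂ = a⁻¹ · (y₁ + 1#)
    translate : ∀ {x} → OnLine a x → OnLine b (x + t)
    translate {x} = Equivalence.to (ℓₐ+t≡ℓ_b x)
    x₁∈ℓₐ : OnLine a x₁
    x₁∈ℓₐ = trans (cong T (x·[x⁻¹·y]≡y a a≢0 y₁)) T-y₁
    x₂∈ℓₐ : OnLine a x₂
    x₂∈ℓₐ = begin
      T (a · x₂)         ≡⟨ cong T (x·[x⁻¹·y]≡y a a≢0 (y₁ + 1#)) ⟩
      T (y₁ + 1#)        ≡⟨ T-+ y₁ 1# ⟩
      T y₁ + T 1#        ≡⟨ cong₂ _+_ T-y₁ (InF⇒T≡0 InF-1) ⟩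
      1# + 0#            ≡⟨ +-identityʳ 1# ⟩
      1#                 ∎

  mutuallyParallel⇒collinear : ∀ {a b c} → a ≢ 0# → MutuallyParallel a b c → Collinear a b c
  mutuallyParallel⇒collinear {a} {b} {c} a≢0 (ℓₐ∥ℓ_b , _ , ℓₐ∥ℓ_c) =
    0# , a , a≢0 , (1# , InF-1 , sym (trans (+-identityˡ _) (*-identityˡ a))) ,
    (b · a⁻¹ , parallel⇒ratio∈F a≢0 ℓₐ∥ℓ_b , sym (multiple b)) ,
    (c · a⁻¹ , parallel⇒ratio∈F a≢0 ℓₐ∥ℓ_c , sym (multiple c))
    where
    a⁻¹ : Carrier
    a⁻¹ = inv a a≢0
    multiple : ∀ p → 0# + p · a⁻¹ · a ≡ p
    multiple p = begin
      0# + p · a⁻¹ · a  ≡⟨ +-identityˡ _ ⟩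
      p · a⁻¹ · a       ≡⟨ *-assoc p a⁻¹ a ⟩
      p · (a⁻¹ · a)     ≡⟨ cong (p ·_) (*-inverseˡ a a≢0) ⟩
      p · 1#            ≡⟨ *-identityʳ p ⟩
      p                 ∎

  -- ℓ_{σd} = {x : T(d x) = σ⁻¹}, and T(d t) = σ⁻¹ + τ⁻¹ for the translation t.
  F-multiples-parallel : ∀ {σ τ d} → InF σ → InF τ → (σ≢0 : σ ≢ 0#) (τ≢0 : τ ≢ 0#) (d≢0 : d ≢ 0#) →
    Parallel (σ · d) (τ · d)
  F-multiples-parallel {σ} {τ} {d} σ∈F τ∈F σ≢0 τ≢0 d≢0 = t , λ x → mk⇔ (to x) (from x)
    where
    σ⁻¹ τ⁻¹ t : Carrier
    σ⁻¹ = inv σ σ≢0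
    τ⁻¹ = inv τ τ≢0
    t = inv d d≢0 · ((σ⁻¹ + τ⁻¹) · y₁)
    T[σdx] : ∀ x → T (σ · d · x) ≡ σ · T (d · x)
    T[σdx] x = trans (cong T (*-assoc σ d x)) (T-· (d · x) σ∈F)
    T[τd[x+t]] : ∀ x → T (τ · d · (x + t)) ≡ τ · (T (d · x) + (σ⁻¹ + τ⁻¹))
    T[τd[x+t]] x = begin
      T (τ · d · (x + t))                ≡⟨ cong T (solve 4 (λ τ d x t → τ :* d :* (x :+ t) := τ :* (d :* x :+ d :* t))
                                                      refl τ d x t) ⟩
      T (τ · (d · x + d · t))            ≡⟨ T-· (d · x + d · t) τ∈F ⟩
      τ · T (d · x + d · t)              ≡⟨ cong (λ z → τ · T (d · x + z)) (x·[x⁻¹·y]≡y d d≢0 _) ⟩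
      τ · T (d · x + (σ⁻¹ + τ⁻¹) · y₁)   ≡⟨ cong (τ ·_) (T-+ (d · x) _) ⟩
      τ · (T (d · x) + T ((σ⁻¹ + τ⁻¹) · y₁)) ≡⟨ cong (λ z → τ · (T (d · x) + z))
                                                   (T-[s·y₁] (InF-+ (InF-inv σ≢0 σ∈F) (InF-inv τ≢0 τ∈F))) ⟩
      τ · (T (d · x) + (σ⁻¹ + τ⁻¹))      ∎
    to : ∀ x → OnLine (σ · d) x → OnLine (τ · d) (x + t)
    to x x∈ℓ = begin
      T (τ · d · (x + t))           ≡⟨ T[τd[x+t]] x ⟩
      τ · (T (d · x) + (σ⁻¹ + τ⁻¹)) ≡⟨ cong (λ z → τ · (z + (σ⁻¹ + τ⁻¹))) (inv-unique σ σ≢0 (trans (sym (T[σdx] x)) x∈ℓ)) ⟩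
      τ · (σ⁻¹ + (σ⁻¹ + τ⁻¹))       ≡⟨ cong (τ ·_) (x+[x+y]≡y σ⁻¹ τ⁻¹) ⟩
      τ · τ⁻¹                       ≡⟨ *-inverseʳ τ τ≢0 ⟩
      1#                            ∎
    from : ∀ x → OnLine (τ · d) (x + t) → OnLine (σ · d) x
    from x x+t∈ℓ = begin
      T (σ · d · x)   ≡⟨ T[σdx] x ⟩
      σ · T (d · x)   ≡⟨ cong (σ ·_) T[dx]≡σ⁻¹ ⟩
      σ · σ⁻¹         ≡⟨ *-inverseʳ σ σ≢0 ⟩
      1#              ∎
      where
      T[dx]≡σ⁻¹ : T (d · x) ≡ σ⁻¹
      T[dx]≡σ⁻¹ = x+y≡0⇒x≡y (x≡x+y⇒y≡0 (begin
        τ⁻¹                                ≡⟨ sym (inv-unique τ τ≢0 (trans (sym (T[τd[x+t]] x)) x+t∈ℓ)) ⟩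
        T (d · x) + (σ⁻¹ + τ⁻¹)            ≡⟨ solve 3 (λ z s t → z :+ (s :+ t) := t :+ (z :+ s)) refl (T (d · x)) σ⁻¹ τ⁻¹ ⟩
        τ⁻¹ + (T (d · x) + σ⁻¹)            ∎))

  -- With the points on a₀ + F d, put w = a₀ d⁻¹: if w ∉ F all ℓₚ pass through (T(w) d)⁻¹,
  -- and if w ∈ F the points are F-multiples of d.
  collinear⇒concurrent⊎mutuallyParallel : ∀ {a b c} → a ≢ 0# → b ≢ 0# → c ≢ 0# →
    Collinear a b c → Concurrent a b c ⊎ MutuallyParallel a b c
  collinear⇒concurrent⊎mutuallyParallel {a} {b} {c} a≢0 b≢0 c≢0
    (a₀ , d , d≢0 , (s₁ , s₁∈F , a≡) , (s₂ , s₂∈F , b≡) , (s₃ , s₃∈F , c≡)) = cases (frob w ≟ w)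
    where
    d⁻¹ w : Carrier
    d⁻¹ = inv d d≢0
    w = a₀ · d⁻¹

    asMultiple : ∀ {p s} → p ≡ a₀ + s · d → p ≡ (w + s) · d
    asMultiple {p} {s} p≡ = trans p≡ (sym (begin
      (w + s) · d          ≡⟨ solve 3 (λ w s d → (w :+ s) :* d := w :* d :+ s :* d) refl w s d ⟩
      a₀ · d⁻¹ · d + s · d ≡⟨ cong (_+ s · d) (trans (*-assoc a₀ d⁻¹ d) (trans (cong (a₀ ·_) (*-inverseˡ d d≢0)) (*-identityʳ a₀))) ⟩
      a₀ + s · d           ∎))

    factor≢0 : ∀ {p s} → p ≢ 0# → p ≡ a₀ + s · d → w + s ≢ 0#
    factor≢0 {p} p≢0 p≡ w+s≡0 = p≢0 (trans (asMultiple p≡) (trans (cong (_· d) w+s≡0) (zeroˡ d)))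

    parallel : ∀ {p r s s′} → InF w → p ≢ 0# → r ≢ 0# → InF s → InF s′ →
      p ≡ a₀ + s · d → r ≡ a₀ + s′ · d → Parallel p r
    parallel w∈F p≢0 r≢0 s∈F s′∈F p≡ r≡ = subst₂ Parallel (sym (asMultiple p≡)) (sym (asMultiple r≡))
      (F-multiples-parallel (InF-+ w∈F s∈F) (InF-+ w∈F s′∈F) (factor≢0 p≢0 p≡) (factor≢0 r≢0 r≡) d≢0)

    onLine : ∀ {p s} (w∉F : ¬ InF w) → InF s → p ≡ a₀ + s · d → OnLine p (inv (T w) (w∉F ∘ T≡0⇒InF) · d⁻¹)
    onLine {p} {s} w∉F s∈F p≡ = begin
      T (p · (u⁻¹ · d⁻¹))                   ≡⟨ cong (λ z → T (z · (u⁻¹ · d⁻¹))) p≡ ⟩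
      T ((a₀ + s · d) · (u⁻¹ · d⁻¹))        ≡⟨ cong T (solve 5 (λ a₀ s d u⁻¹ d⁻¹ → (a₀ :+ s :* d) :* (u⁻¹ :* d⁻¹)
                                                                := u⁻¹ :* (a₀ :* d⁻¹) :+ u⁻¹ :* s :* (d :* d⁻¹))
                                                           refl a₀ s d u⁻¹ d⁻¹) ⟩
      T (u⁻¹ · w + u⁻¹ · s · (d · d⁻¹))     ≡⟨ cong (λ z → T (u⁻¹ · w + u⁻¹ · s · z)) (*-inverseʳ d d≢0) ⟩
      T (u⁻¹ · w + u⁻¹ · s · 1#)            ≡⟨ cong (λ z → T (u⁻¹ · w + z)) (*-identityʳ _) ⟩
      T (u⁻¹ · w + u⁻¹ · s)                 ≡⟨ T-+ (u⁻¹ · w) (u⁻¹ · s) ⟩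
      T (u⁻¹ · w) + T (u⁻¹ · s)             ≡⟨ cong₂ _+_ (T-· w u⁻¹∈F) (InF⇒T≡0 (InF-· u⁻¹∈F s∈F)) ⟩
      u⁻¹ · T w + 0#                        ≡⟨ +-identityʳ _ ⟩
      u⁻¹ · T w                             ≡⟨ *-inverseˡ (T w) Tw≢0 ⟩
      1#                                    ∎
      where
      Tw≢0 : T w ≢ 0#
      Tw≢0 = w∉F ∘ T≡0⇒InF
      u⁻¹ : Carrier
      u⁻¹ = inv (T w) Tw≢0
      u⁻¹∈F : InF u⁻¹
      u⁻¹∈F = InF-inv Tw≢0 (T-InF w)

    cases : Dec (InF w) → Concurrent a b c ⊎ MutuallyParallel a b c
    cases (yes w∈F) = inj₂ ( parallel w∈F a≢0 b≢0 s₁∈F s₂∈F a≡ b≡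
                           , parallel w∈F b≢0 c≢0 s₂∈F s₃∈F b≡ c≡
                           , parallel w∈F a≢0 c≢0 s₁∈F s₃∈F a≡ c≡)
    cases (no w∉F)  = inj₁ (_ , onLine w∉F s₁∈F a≡ , onLine w∉F s₂∈F b≡ , onLine w∉F s₃∈F c≡)

  noThreeCollinear⇔lineOval : (pt : Fin (suc q) → Carrier) → (∀ i → pt i ≢ 0#) →
    NoThreeCollinear pt ⇔ LineOval pt
  noThreeCollinear⇔lineOval pt pt≢0 = mk⇔ to from
    where
    to : NoThreeCollinear pt → LineOval pt
    to noCol i j k i≢j j≢k i≢k =
      noCol i j k i≢j j≢k i≢k ∘ concurrent⇒collinear ,
      noCol i j k i≢j j≢k i≢k ∘ mutuallyParallel⇒collinear (pt≢0 i)
    from : LineOval pt → NoThreeCollinear pt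
    from oval i j k i≢j j≢k i≢k col
      with collinear⇒concurrent⊎mutuallyParallel (pt≢0 i) (pt≢0 j) (pt≢0 k) col
    ... | inj₁ concurrent = proj₁ (oval i j k i≢j j≢k i≢k) concurrent
    ... | inj₂ parallel   = proj₂ (oval i j k i≢j j≢k i≢k) parallel

lemma3p4 : (m : ℕ) → 1 ≤ m → (K : FiniteField ((2 ^ m) * (2 ^ m))) →
    (pt : Fin (suc (2 ^ m)) → FiniteField.Carrier K) →
    Injective _≡_ _≡_ pt → (∀ i → pt i ≢ FiniteField.0# K) →
    (Geometry.NoThreeCollinear m K pt ⇔ Geometry.LineOval m K pt)
lemma3p4 zero     () K pt _ pt≢0
lemma3p4 (suc m′) _  K pt _ pt≢0 = LineOvalDuality.noThreeCollinear⇔lineOval m′ K pt pt≢0
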